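{- Let $S$ be a set of $q>2$ elements, $d\ge1$, and let $\Gamma$ be a commutative weakly distance-regular digraph with vertex set $S^d$ whose underlying graph is the Hamming graph $H(d,q)$ on $S^d$. Let $1\le i\le d$ and $\alpha\in S^{d-1}$. Then $d^+_{\Gamma_i(\alpha)}(x)=d^+_{\Gamma_i(\alpha)}(y)$ and $d^-_{\Gamma_i(\alpha)}(x)=d^-_{\Gamma_i(\alpha)}(y)$ for all $x,y\in V(\Gamma_i(\alpha))$.
   Context: Digraphs have arcs as ordered pairs of distinct vertices; $\partial_\Gamma$ is directed distance, $\tilde\partial_\Gamma(x,y)=(\partial_\Gamma(x,y),\partial_\Gamma(y,x))$. A strongly connected $\Gamma$ is weakly distance-regular if the number of $z$ with $\tilde\partial_\Gamma(x,z)=\tilde i$, $\tilde\partial_\Gamma(z,y)=\tilde j$ depends only on $\tilde i,\tilde j,\tilde\partial_\Gamma(x,y)$; commutative if this number is symmetric in $\tilde i,\tilde j$. The underlying graph has $x\sim y$ iff $(x,y)$ or $(y,x)$ is an arc. $H(d,q)$ on $S^d$: two tuples adjacent iff they differ in exactly one coordinate. For $\alpha=(a_1,\dots,a_{d-1})\in S^{d-1}$, $\Gamma_i(\alpha)$ is the induced subdigraph of $\Gamma$ on $\{(a_1,\dots,a_{i-1},b,a_i,\dots,a_{d-1}):b\in S\}$; $d^{+}_{\Gamma_i(\alpha)}(x)$, $d^-_{\Gamma_i(\alpha)}(x)$ are the numbers of out-/in-neighbours of $x$ in $\Gamma_i(\alpha)$. -}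

module Defs where

open import Data.Nat using (ℕ; zero; suc; _+_)
import Data.Nat as ℕ
open import Data.Bool using (Bool; true; false; _∧_; _∨_; if_then_else_)
open import Data.Fin using (Fin)
import Data.Fin as F
open import Data.Vec using (Vec; []; _∷_)
import Data.Vec.Properties as VP
open import Data.List using (List; []; _∷_; map; concatMap; filter; length)
open import Data.Bool.ListAction using (any)
open import Data.List.Base using (allFin)
open import Data.Product using (_×_; _,_; ∃)
open import Relation.Nullary.Decidable using (⌊_⌋)
open import Relation.Binary.PropositionalEquality using (_≡_)

V : ℕ → ℕ → Set
V q d = Vec (Fin q) d

allVecs : ∀ {q} d → List (V q d)
allVecs zero = [] ∷ []
allVecs {q} (suc d) = concatMap (λ a → map (a ∷_) (allVecs d)) (allFin q)

_==V_ : ∀ {q d} → V q d → V q d → Bool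
x ==V y = ⌊ VP.≡-dec F._≟_ x y ⌋

Digraph : ℕ → ℕ → Set
Digraph q d = V q d → V q d → Bool

hamming : ∀ {q d} → V q d → V q d → ℕ
hamming [] [] = 0
hamming (a ∷ x) (b ∷ y) = (if ⌊ a F.≟ b ⌋ then 0 else 1) + hamming x y

module _ {q d : ℕ} (Γ : Digraph q d) where

  walk : ℕ → V q d → V q d → Bool
  walk zero x y = x ==V y
  walk (suc n) x y = any (λ z → Γ x z ∧ walk n z y) (allVecs d)

  StronglyConnected : Set
  StronglyConnected = ∀ x y → ∃ λ n → walk n x y ≡ true

  -- least n < bound with f n, or bound if none
  firstTrue : ℕ → (ℕ → Bool) → ℕ
  firstTrue zero f = zero
  firstTrue (suc b) f = if f zero then zero else suc (firstTrue b (λ n → f (suc n)))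

  -- directed distance ∂_Γ(x,y) (the length of a shortest directed walk,
  -- which is < |S^d| whenever one exists)
  ∂ : V q d → V q d → ℕ
  ∂ x y = firstTrue (length (allVecs {q} d)) (λ n → walk n x y)

  ∂̃ : V q d → V q d → ℕ × ℕ
  ∂̃ x y = ∂ x y , ∂ y x

  _==₂_ : ℕ × ℕ → ℕ × ℕ → Bool
  (a , b) ==₂ (c , e) = ⌊ a ℕ.≟ c ⌋ ∧ ⌊ b ℕ.≟ e ⌋

  p : ℕ × ℕ → ℕ × ℕ → V q d → V q d → ℕ
  p i j x y = length (filter (λ z → Data.Bool._≟_ ((∂̃ x z ==₂ i) ∧ (∂̃ z y ==₂ j)) true) (allVecs d))
    where import Data.Bool

  WeaklyDistanceRegular : Set
  WeaklyDistanceRegular =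
    StronglyConnected ×
    (∀ i j x y x' y' → ∂̃ x y ≡ ∂̃ x' y' → p i j x y ≡ p i j x' y')

  Commutative : Set
  Commutative = ∀ i j x y → p i j x y ≡ p j i x y

  Loopless : Set
  Loopless = ∀ x → Γ x x ≡ false

  UnderlyingHamming : Set
  UnderlyingHamming = ∀ x y → ((Γ x y ∨ Γ y x) ≡ true → hamming x y ≡ 1)
                            × (hamming x y ≡ 1 → (Γ x y ∨ Γ y x) ≡ true)

-- Γ_i(α) for Γ on S^(suc n), i : Fin (suc n), α ∈ S^n: vertex set
-- { insertAt α i b | b ∈ S }.  Out-/in-degree of insertAt α i b in Γ_i(α).
module _ {q n : ℕ} (Γ : Digraph q (suc n)) (i : Fin (suc n)) (α : V q n) where

  fibre : Fin q → V q (suc n)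
  fibre b = Data.Vec.insertAt α i b

  outdeg : Fin q → ℕ
  outdeg b = length (filter (λ c → Data.Bool._≟_ (Γ (fibre b) (fibre c)) true) (allFin q))
    where import Data.Bool

  indeg : Fin q → ℕ
  indeg b = length (filter (λ c → Data.Bool._≟_ (Γ (fibre c) (fibre b)) true) (allFin q))
    where import Data.Bool

{-# OPTIONS --safe #-}
-- Let x ≠ y be two points of the line Γ_i(α). A vertex that is Hamming-adjacent to both
-- of them lies on the line, so counting the z with x → z and z adjacent to y gives
-- d⁺(x) − [x → y], while counting the z with z → y and z adjacent to x gives
-- d⁻(y) − [x → y]. Both counts are sums of intersection numbers p_{ĩ,j̃}(x,y) (an arc is a
-- pair at distance one), and the second is obtained from the first by exchanging ĩ and j̃,
-- which commutativity allows. Hence d⁺(x) = d⁻(y) whenever x ≠ y, and since the line has a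
-- third point w, d⁺(x) = d⁻(w) = d⁺(y) and d⁻(x) = d⁺(w) = d⁻(y).
module Submission where

open import Defs
open import Data.Bool using (Bool; true; false; not; _∧_; _∨_; if_then_else_)
import Data.Bool as Bool
open import Data.Bool.Properties using (∨-comm; ∧-identityʳ; ∧-zeroʳ)
open import Data.Bool.ListAction using (any)
open import Data.Empty using (⊥-elim)
open import Data.Fin using (Fin; punchIn; punchOut)
import Data.Fin as Fin
open import Data.Fin.Properties using (suc-injective; punchInᵢ≢i; punchIn-injective; punchIn-punchOut)
open import Data.List using (List; []; _∷_; _++_; map; concatMap; filter; length; allFin; downFrom; cartesianProduct)
open import Data.List.Properties using (map-tabulate; length-tabulate)
open import Data.Nat using (ℕ; zero; suc; _+_; _*_; _^_; _≤_; _<_; _>_; _≡ᵇ_; z≤n; s≤s)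
import Data.Nat as ℕ
open import Data.Nat.Properties
  using (+-identityʳ; +-assoc; *-identityʳ; *-zeroʳ; *-comm; *-distribˡ-+; +-commutativeSemigroup;
         ≤-refl; ≤-trans; <⇒≤; <⇒≢; <-irrefl; m<1+n⇒m<n∨m≡n; m≤m*n; m^n≢0; m+n≡0⇒m≡0; m+n≡0⇒n≡0)
open import Algebra.Properties.CommutativeSemigroup +-commutativeSemigroup using (interchange; x∙yz≈y∙xz)
open import Data.Product using (_×_; _,_; ∃; proj₁; proj₂; uncurry)
open import Data.Sum using (inj₁; inj₂)
open import Data.Vec using ([]; _∷_; insertAt)
open import Data.Vec.Properties using (∷-injectiveˡ; ∷-injectiveʳ; ≡-dec)
open import Function using (_∘_; flip)
open import Relation.Nullary using (Dec; yes; no; ¬_)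
open import Relation.Nullary.Decidable using (⌊_⌋; isYes≗does; dec-true; dec-false)
open import Relation.Binary.PropositionalEquality

private
  variable
    A B K : Set
    q d : ℕ

toℕ : Bool → ℕ
toℕ false = 0
toℕ true = 1

toℕ-∧ : ∀ a b → toℕ (a ∧ b) ≡ toℕ a * toℕ b
toℕ-∧ false b = refl
toℕ-∧ true b = sym (+-identityʳ (toℕ b))

toℕ-not+toℕ : ∀ m b → m * toℕ (not b) + m * toℕ b ≡ m
toℕ-not+toℕ m false = trans (cong₂ _+_ (*-identityʳ m) (*-zeroʳ m)) (+-identityʳ m)
toℕ-not+toℕ m true = trans (cong (_+ m * 1) (*-zeroʳ m)) (*-identityʳ m)

⌊⌋-true : ∀ {P : Set} (P? : Dec P) → P → ⌊ P? ⌋ ≡ true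
⌊⌋-true P? p = trans (isYes≗does P?) (dec-true P? p)

⌊⌋-false : ∀ {P : Set} (P? : Dec P) → ¬ P → ⌊ P? ⌋ ≡ false
⌊⌋-false P? ¬p = trans (isYes≗does P?) (dec-false P? ¬p)

∑ : List A → (A → ℕ) → ℕ
∑ [] f = 0
∑ (x ∷ xs) f = f x + ∑ xs f

∑-cong : ∀ (xs : List A) {f g : A → ℕ} → (∀ a → f a ≡ g a) → ∑ xs f ≡ ∑ xs g
∑-cong [] _ = refl
∑-cong (x ∷ xs) f≗g = cong₂ _+_ (f≗g x) (∑-cong xs f≗g)

∑-zero : ∀ (xs : List A) {f : A → ℕ} → (∀ a → f a ≡ 0) → ∑ xs f ≡ 0
∑-zero [] _ = refl
∑-zero (x ∷ xs) f≗0 = cong₂ _+_ (f≗0 x) (∑-zero xs f≗0)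

∑-+ : ∀ (xs : List A) (f g : A → ℕ) → ∑ xs (λ a → f a + g a) ≡ ∑ xs f + ∑ xs g
∑-+ [] f g = refl
∑-+ (x ∷ xs) f g = trans (cong (f x + g x +_) (∑-+ xs f g)) (interchange (f x) (g x) _ _)

∑-*ˡ : ∀ (xs : List A) k (f : A → ℕ) → ∑ xs (λ a → k * f a) ≡ k * ∑ xs f
∑-*ˡ [] k f = sym (*-zeroʳ k)
∑-*ˡ (x ∷ xs) k f = trans (cong (k * f x +_) (∑-*ˡ xs k f)) (sym (*-distribˡ-+ k (f x) _))

∑-*ʳ : ∀ (xs : List A) k (f : A → ℕ) → ∑ xs (λ a → f a * k) ≡ ∑ xs f * k
∑-*ʳ xs k f = trans (∑-cong xs (λ a → *-comm (f a) k)) (trans (∑-*ˡ xs k f) (*-comm k _))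

∑-const : ∀ (xs : List A) k → ∑ xs (λ _ → k) ≡ length xs * k
∑-const [] k = refl
∑-const (x ∷ xs) k = cong (k +_) (∑-const xs k)

∑-++ : ∀ (xs ys : List A) f → ∑ (xs ++ ys) f ≡ ∑ xs f + ∑ ys f
∑-++ [] ys f = refl
∑-++ (x ∷ xs) ys f = trans (cong (f x +_) (∑-++ xs ys f)) (sym (+-assoc (f x) _ _))

∑-map : ∀ (g : A → B) xs f → ∑ (map g xs) f ≡ ∑ xs (f ∘ g)
∑-map g [] f = refl
∑-map g (x ∷ xs) f = cong (f (g x) +_) (∑-map g xs f)

∑-concatMap : ∀ (g : A → List B) xs f → ∑ (concatMap g xs) f ≡ ∑ xs (λ a → ∑ (g a) f)
∑-concatMap g [] f = refl
∑-concatMap g (x ∷ xs) f = trans (∑-++ (g x) _ f) (cong (∑ (g x) f +_) (∑-concatMap g xs f))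

∑-comm : ∀ (xs : List A) (ys : List B) (f : A → B → ℕ) →
  ∑ xs (λ a → ∑ ys (f a)) ≡ ∑ ys (λ b → ∑ xs (λ a → f a b))
∑-comm [] ys f = sym (∑-zero ys (λ _ → refl))
∑-comm (x ∷ xs) ys f = trans (cong (∑ ys (f x) +_) (∑-comm xs ys f)) (sym (∑-+ ys (f x) _))

∑-cartesianProduct : ∀ (xs : List A) (ys : List B) f →
  ∑ (cartesianProduct xs ys) f ≡ ∑ xs (λ a → ∑ ys (λ b → f (a , b)))
∑-cartesianProduct [] ys f = refl
∑-cartesianProduct (x ∷ xs) ys f = begin
  ∑ (map (x ,_) ys ++ cartesianProduct xs ys) f          ≡⟨ ∑-++ (map (x ,_) ys) _ f ⟩
  ∑ (map (x ,_) ys) f + ∑ (cartesianProduct xs ys) f     ≡⟨ cong₂ _+_ (∑-map (x ,_) ys f) (∑-cartesianProduct xs ys f) ⟩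
  ∑ ys (λ b → f (x , b)) + ∑ xs (λ a → ∑ ys (λ b → f (a , b))) ∎
  where open ≡-Reasoning

∑-cartesianProduct-* : ∀ (xs : List A) (ys : List B) f g →
  ∑ (cartesianProduct xs ys) (λ k → f (proj₁ k) * g (proj₂ k)) ≡ ∑ xs f * ∑ ys g
∑-cartesianProduct-* xs ys f g = begin
  ∑ (cartesianProduct xs ys) (λ k → f (proj₁ k) * g (proj₂ k)) ≡⟨ ∑-cartesianProduct xs ys _ ⟩
  ∑ xs (λ a → ∑ ys (λ b → f a * g b))                          ≡⟨ ∑-cong xs (λ a → ∑-*ˡ ys (f a) g) ⟩
  ∑ xs (λ a → f a * ∑ ys g)                                    ≡⟨ ∑-*ʳ xs (∑ ys g) f ⟩
  ∑ xs f * ∑ ys g                                              ∎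
  where open ≡-Reasoning

∑-cartesianProduct-flip : ∀ (xs : List A) (f : A → A → ℕ) →
  ∑ (cartesianProduct xs xs) (uncurry f) ≡ ∑ (cartesianProduct xs xs) (uncurry (flip f))
∑-cartesianProduct-flip xs f = begin
  ∑ (cartesianProduct xs xs) (uncurry f)        ≡⟨ ∑-cartesianProduct xs xs _ ⟩
  ∑ xs (λ a → ∑ xs (f a))                       ≡⟨ ∑-comm xs xs f ⟩
  ∑ xs (λ b → ∑ xs (λ a → f a b))               ≡⟨ sym (∑-cartesianProduct xs xs _) ⟩
  ∑ (cartesianProduct xs xs) (uncurry (flip f)) ∎
  where open ≡-Reasoning

length-filter≡∑ : ∀ (P : A → Bool) xs → length (filter (λ a → P a Bool.≟ true) xs) ≡ ∑ xs (toℕ ∘ P)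
length-filter≡∑ P [] = refl
length-filter≡∑ P (x ∷ xs) with P x
... | true = cong suc (length-filter≡∑ P xs)
... | false = length-filter≡∑ P xs

any-≡ : ∀ (g : A → Bool) xs {b} → ∑ xs (toℕ ∘ g) ≡ toℕ b → any g xs ≡ b
any-≡ g [] {false} _ = refl
any-≡ g (x ∷ xs) {b} count with g x
any-≡ g (x ∷ xs) {true} count | true = refl
any-≡ g (x ∷ xs) {b} count | false = any-≡ g xs count

∑-by-value : ∀ (xs : List A) (ks : List K) (key : A → K) (_≈_ : K → K → Bool) →
  (∀ {k k′} → k ≈ k′ ≡ true → k ≡ k′) → (∀ a → ∑ ks (λ k → toℕ (key a ≈ k)) ≡ 1) →
  ∀ W → ∑ xs (W ∘ key) ≡ ∑ ks (λ k → W k * ∑ xs (λ a → toℕ (key a ≈ k)))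
∑-by-value xs ks key _≈_ ≈⇒≡ counted-once W = begin
  ∑ xs (W ∘ key)                                     ≡⟨ ∑-cong xs spread ⟩
  ∑ xs (λ a → ∑ ks (λ k → W k * toℕ (key a ≈ k)))    ≡⟨ ∑-comm xs ks _ ⟩
  ∑ ks (λ k → ∑ xs (λ a → W k * toℕ (key a ≈ k)))    ≡⟨ ∑-cong ks (λ k → ∑-*ˡ xs (W k) _) ⟩
  ∑ ks (λ k → W k * ∑ xs (λ a → toℕ (key a ≈ k)))    ∎
  where
  open ≡-Reasoning
  matching : ∀ a k → W (key a) * toℕ (key a ≈ k) ≡ W k * toℕ (key a ≈ k)
  matching a k with key a ≈ k in eq
  ... | true = cong (λ k′ → W k′ * 1) (≈⇒≡ eq)
  ... | false = trans (*-zeroʳ (W (key a))) (sym (*-zeroʳ (W k)))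
  spread : ∀ a → W (key a) ≡ ∑ ks (λ k → W k * toℕ (key a ≈ k))
  spread a = begin
    W (key a)                                   ≡⟨ sym (*-identityʳ _) ⟩
    W (key a) * 1                               ≡⟨ cong (W (key a) *_) (sym (counted-once a)) ⟩
    W (key a) * ∑ ks (λ k → toℕ (key a ≈ k))    ≡⟨ sym (∑-*ˡ ks (W (key a)) (λ k → toℕ (key a ≈ k))) ⟩
    ∑ ks (λ k → W (key a) * toℕ (key a ≈ k))    ≡⟨ ∑-cong ks (matching a) ⟩
    ∑ ks (λ k → W k * toℕ (key a ≈ k))          ∎

∑-allFin-suc : ∀ (f : Fin (suc q) → ℕ) → ∑ (allFin (suc q)) f ≡ f Fin.zero + ∑ (allFin q) (f ∘ Fin.suc)
∑-allFin-suc {q} f =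
  cong (f Fin.zero +_) (trans (cong (λ xs → ∑ xs f) (sym (map-tabulate (λ a → a) Fin.suc))) (∑-map Fin.suc (allFin q) f))

∑-allFin-point : ∀ (f : Fin q → ℕ) a₀ → (∀ a → a ≢ a₀ → f a ≡ 0) → ∑ (allFin q) f ≡ f a₀
∑-allFin-point {suc q} f Fin.zero f≗0 =
  trans (∑-allFin-suc f) (trans (cong (f Fin.zero +_) (∑-zero (allFin q) (λ a → f≗0 (Fin.suc a) (λ ())))) (+-identityʳ _))
∑-allFin-point {suc q} f (Fin.suc a₀) f≗0 =
  trans (∑-allFin-suc f) (trans (cong (_+ ∑ (allFin q) (f ∘ Fin.suc)) (f≗0 Fin.zero (λ ())))
    (∑-allFin-point (f ∘ Fin.suc) a₀ (λ a a≢a₀ → f≗0 (Fin.suc a) (a≢a₀ ∘ suc-injective))))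

∑-allFin-except : ∀ (g : Fin q → ℕ) c → ∑ (allFin q) (λ a → g a * toℕ (not ⌊ a Fin.≟ c ⌋)) + g c ≡ ∑ (allFin q) g
∑-allFin-except {q} g c = begin
  ∑ (allFin q) (λ a → g a * toℕ (not ⌊ a Fin.≟ c ⌋)) + g c
    ≡⟨ cong (∑ (allFin q) (λ a → g a * toℕ (not ⌊ a Fin.≟ c ⌋)) +_) (sym at-c) ⟩
  ∑ (allFin q) (λ a → g a * toℕ (not ⌊ a Fin.≟ c ⌋)) + ∑ (allFin q) (λ a → g a * toℕ ⌊ a Fin.≟ c ⌋)
    ≡⟨ sym (∑-+ (allFin q) _ _) ⟩
  ∑ (allFin q) (λ a → g a * toℕ (not ⌊ a Fin.≟ c ⌋) + g a * toℕ ⌊ a Fin.≟ c ⌋)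
    ≡⟨ ∑-cong (allFin q) (λ a → toℕ-not+toℕ (g a) ⌊ a Fin.≟ c ⌋) ⟩
  ∑ (allFin q) g ∎
  where
  open ≡-Reasoning
  at-c : ∑ (allFin q) (λ a → g a * toℕ ⌊ a Fin.≟ c ⌋) ≡ g c
  at-c = trans (∑-allFin-point _ c (λ a a≢c → trans (cong (λ t → g a * toℕ t) (⌊⌋-false (a Fin.≟ c) a≢c)) (*-zeroʳ (g a))))
               (trans (cong (λ t → g c * toℕ t) (⌊⌋-true (c Fin.≟ c) refl)) (*-identityʳ (g c)))

∑-downFrom-beyond : ∀ {m a} → m ≤ a → ∑ (downFrom m) (λ k → toℕ ⌊ a ℕ.≟ k ⌋) ≡ 0
∑-downFrom-beyond {zero} _ = refl
∑-downFrom-beyond {suc m} {a} m<a =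
  cong₂ _+_ (cong toℕ (⌊⌋-false (a ℕ.≟ m) (λ a≡m → <-irrefl (sym a≡m) m<a))) (∑-downFrom-beyond (<⇒≤ m<a))

∑-downFrom-point : ∀ {m a} → a < m → ∑ (downFrom m) (λ k → toℕ ⌊ a ℕ.≟ k ⌋) ≡ 1
∑-downFrom-point {suc m} {a} a<1+m with m<1+n⇒m<n∨m≡n a<1+m
... | inj₁ a<m = cong₂ _+_ (cong toℕ (⌊⌋-false (a ℕ.≟ m) (<⇒≢ a<m))) (∑-downFrom-point a<m)
... | inj₂ refl = cong₂ _+_ (cong toℕ (⌊⌋-true (a ℕ.≟ a) refl)) (∑-downFrom-beyond {a} ≤-refl)

∑-allVecs-suc : ∀ (f : V q (suc d) → ℕ) → ∑ (allVecs (suc d)) f ≡ ∑ (allFin q) (λ a → ∑ (allVecs d) (λ w → f (a ∷ w)))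
∑-allVecs-suc {q} {d} f =
  trans (∑-concatMap _ (allFin q) f) (∑-cong (allFin q) (λ a → ∑-map (a ∷_) (allVecs d) f))

length-allVecs : ∀ d → length (allVecs {q} d) ≡ q ^ d
length-allVecs zero = refl
length-allVecs {q} (suc d) = begin
  length (allVecs {q} (suc d))                        ≡⟨ sym (count (suc d)) ⟩
  ∑ (allVecs {q} (suc d)) (λ _ → 1)                   ≡⟨ ∑-allVecs-suc {q} {d} (λ _ → 1) ⟩
  ∑ (allFin q) (λ _ → ∑ (allVecs {q} d) (λ _ → 1))    ≡⟨ ∑-const (allFin q) _ ⟩
  length (allFin q) * ∑ (allVecs {q} d) (λ _ → 1)     ≡⟨ cong₂ _*_ (length-tabulate {n = q} (λ a → a)) (trans (count d) (length-allVecs d)) ⟩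
  q * q ^ d                                           ∎
  where
  open ≡-Reasoning
  count : ∀ d → ∑ (allVecs {q} d) (λ _ → 1) ≡ length (allVecs {q} d)
  count d = trans (∑-const (allVecs d) 1) (*-identityʳ _)

2≤length-allVecs : 2 ≤ q → ∀ n → 2 ≤ length (allVecs {q} (suc n))
2≤length-allVecs {suc (suc k)} 2≤q@(s≤s (s≤s _)) n =
  subst (2 ≤_) (sym (length-allVecs (suc n))) (≤-trans 2≤q (m≤m*n (2 + k) ((2 + k) ^ n) {{m^n≢0 (2 + k) n}}))

∑-allVecs-point : ∀ d (f : V q d → ℕ) v → (∀ w → w ≢ v → f w ≡ 0) → ∑ (allVecs d) f ≡ f v
∑-allVecs-point zero f [] _ = +-identityʳ (f [])
∑-allVecs-point {q} (suc d) f (a ∷ v) f≗0 = begin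
  ∑ (allVecs (suc d)) f                                 ≡⟨ ∑-allVecs-suc f ⟩
  ∑ (allFin q) (λ a′ → ∑ (allVecs d) (λ w → f (a′ ∷ w))) ≡⟨ ∑-allFin-point _ a other-heads ⟩
  ∑ (allVecs d) (λ w → f (a ∷ w))                       ≡⟨ ∑-allVecs-point d _ v (λ w w≢v → f≗0 (a ∷ w) (w≢v ∘ ∷-injectiveʳ)) ⟩
  f (a ∷ v)                                             ∎
  where
  open ≡-Reasoning
  other-heads : ∀ a′ → a′ ≢ a → ∑ (allVecs d) (λ w → f (a′ ∷ w)) ≡ 0
  other-heads a′ a′≢a = ∑-zero (allVecs d) (λ w → f≗0 (a′ ∷ w) (a′≢a ∘ ∷-injectiveˡ))

∑-allVecs-insertAt : ∀ n (i : Fin (suc n)) (f : V q (suc n) → ℕ) →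
  ∑ (allVecs (suc n)) f ≡ ∑ (allFin q) (λ c → ∑ (allVecs n) (λ β → f (insertAt β i c)))
∑-allVecs-insertAt n Fin.zero f = ∑-allVecs-suc f
∑-allVecs-insertAt {q} (suc n) (Fin.suc i) f = begin
  ∑ (allVecs (suc (suc n))) f
    ≡⟨ ∑-allVecs-suc f ⟩
  ∑ (allFin q) (λ a → ∑ (allVecs (suc n)) (λ w → f (a ∷ w)))
    ≡⟨ ∑-cong (allFin q) (λ a → ∑-allVecs-insertAt n i (λ w → f (a ∷ w))) ⟩
  ∑ (allFin q) (λ a → ∑ (allFin q) (λ c → ∑ (allVecs n) (λ β → f (a ∷ insertAt β i c))))
    ≡⟨ ∑-comm (allFin q) (allFin q) _ ⟩
  ∑ (allFin q) (λ c → ∑ (allFin q) (λ a → ∑ (allVecs n) (λ β → f (a ∷ insertAt β i c))))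
    ≡⟨ ∑-cong (allFin q) (λ c → sym (∑-allVecs-suc (λ β → f (insertAt β (Fin.suc i) c)))) ⟩
  ∑ (allFin q) (λ c → ∑ (allVecs (suc n)) (λ β → f (insertAt β (Fin.suc i) c))) ∎
  where open ≡-Reasoning

∑-allVecs-line : ∀ {n} (i : Fin (suc n)) (α : V q n) (f : V q (suc n) → ℕ) →
  (∀ β c → β ≢ α → f (insertAt β i c) ≡ 0) → ∑ (allVecs (suc n)) f ≡ ∑ (allFin q) (λ c → f (insertAt α i c))
∑-allVecs-line {q} {n} i α f off-line≗0 = trans (∑-allVecs-insertAt n i f)
  (∑-cong (allFin q) (λ c → ∑-allVecs-point n _ α (λ β β≢α → off-line≗0 β c β≢α)))

mismatch : Fin q → Fin q → ℕ
mismatch a b = if ⌊ a Fin.≟ b ⌋ then 0 else 1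

mismatch-refl : ∀ (a : Fin q) → mismatch a a ≡ 0
mismatch-refl a rewrite ⌊⌋-true (a Fin.≟ a) refl = refl

mismatch-≢ : ∀ {a b : Fin q} → a ≢ b → mismatch a b ≡ 1
mismatch-≢ {a = a} {b} a≢b rewrite ⌊⌋-false (a Fin.≟ b) a≢b = refl

mismatch≡0⇒≡ : ∀ {a b : Fin q} → mismatch a b ≡ 0 → a ≡ b
mismatch≡0⇒≡ {a = a} {b} _ with a Fin.≟ b
... | yes a≡b = a≡b

hamming-refl : ∀ (x : V q d) → hamming x x ≡ 0
hamming-refl [] = refl
hamming-refl (a ∷ x) = cong₂ _+_ (mismatch-refl a) (hamming-refl x)

hamming≡0⇒≡ : ∀ (x y : V q d) → hamming x y ≡ 0 → x ≡ y
hamming≡0⇒≡ [] [] _ = refl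
hamming≡0⇒≡ (a ∷ x) (b ∷ y) h≡0 =
  cong₂ _∷_ (mismatch≡0⇒≡ (m+n≡0⇒m≡0 (mismatch a b) h≡0)) (hamming≡0⇒≡ x y (m+n≡0⇒n≡0 (mismatch a b) h≡0))

hamming-insertAt : ∀ {n} (α β : V q n) i (b c : Fin q) →
  hamming (insertAt α i b) (insertAt β i c) ≡ mismatch b c + hamming α β
hamming-insertAt α β Fin.zero b c = refl
hamming-insertAt (a ∷ α) (a′ ∷ β) (Fin.suc i) b c =
  trans (cong (mismatch a a′ +_) (hamming-insertAt α β i b c)) (x∙yz≈y∙xz (mismatch a a′) (mismatch b c) _)

adjacent-to-line⇒≡ : ∀ {n} {α β : V q n} {i b c e} → β ≢ α →
  hamming (insertAt α i b) (insertAt β i e) ≡ 1 → hamming (insertAt β i e) (insertAt α i c) ≡ 1 → b ≡ c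
adjacent-to-line⇒≡ {α = α} {β} {i} {b} {c} {e} β≢α b~z z~c = trans
  (mismatch≡0⇒≡ (m+n≡1⇒m≡0 (trans (sym (hamming-insertAt α β i b e)) b~z) (β≢α ∘ sym ∘ hamming≡0⇒≡ α β)))
  (mismatch≡0⇒≡ (m+n≡1⇒m≡0 (trans (sym (hamming-insertAt β α i e c)) z~c) (β≢α ∘ hamming≡0⇒≡ β α)))
  where
  m+n≡1⇒m≡0 : ∀ {m n} → m + n ≡ 1 → n ≢ 0 → m ≡ 0
  m+n≡1⇒m≡0 {zero} _ _ = refl
  m+n≡1⇒m≡0 {suc zero} {zero} _ n≢0 = ⊥-elim (n≢0 refl)

module _ (Γ : Digraph q d) where

  firstTrue-≤ : ∀ b f → firstTrue Γ b f ≤ b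
  firstTrue-≤ zero f = z≤n
  firstTrue-≤ (suc b) f with f 0
  ... | true = z≤n
  ... | false = s≤s (firstTrue-≤ b (f ∘ suc))

  firstTrue≡ᵇ1 : ∀ {b} → 2 ≤ b → ∀ f → (firstTrue Γ b f ≡ᵇ 1) ≡ not (f 0) ∧ f 1
  firstTrue≡ᵇ1 {suc (suc b)} (s≤s (s≤s _)) f with f 0 | f 1
  ... | true | _ = refl
  ... | false | true = refl
  ... | false | false = refl

  walk-1 : ∀ u v → walk Γ 1 u v ≡ Γ u v
  walk-1 u v = any-≡ _ (allVecs d) (trans (∑-allVecs-point d _ v off-v) at-v)
    where
    off-v : ∀ z → z ≢ v → toℕ (Γ u z ∧ (z ==V v)) ≡ 0
    off-v z z≢v = cong toℕ (trans (cong (Γ u z ∧_) (⌊⌋-false (≡-dec Fin._≟_ z v) z≢v)) (∧-zeroʳ (Γ u z)))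
    at-v : toℕ (Γ u v ∧ (v ==V v)) ≡ toℕ (Γ u v)
    at-v = cong toℕ (trans (cong (Γ u v ∧_) (⌊⌋-true (≡-dec Fin._≟_ v v) refl)) (∧-identityʳ (Γ u v)))

  -- ∂ only tries walk lengths below |S^d|, so it detects distance one only when |S^d| ≥ 2.
  ∂≡ᵇ1 : Loopless Γ → 2 ≤ length (allVecs {q} d) → ∀ u v → (∂ Γ u v ≡ᵇ 1) ≡ Γ u v
  ∂≡ᵇ1 loopless 2≤|V| u v = trans (firstTrue≡ᵇ1 2≤|V| _) (trans (cong (not (u ==V v) ∧_) (walk-1 u v)) no-loop)
    where
    arc⇒≢ : Γ u v ≡ true → u ≢ v
    arc⇒≢ arc refl with trans (sym arc) (loopless u)
    ... | ()
    no-loop : not (u ==V v) ∧ Γ u v ≡ Γ u v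
    no-loop with Γ u v in arc
    ... | false = ∧-zeroʳ _
    ... | true rewrite ⌊⌋-false (≡-dec Fin._≟_ u v) (arc⇒≢ arc) = refl

  private
    N : List (V q d)
    N = allVecs d

    -- every distance is at most |S^d|, so the intersection numbers live on R² × R²
    R : List ℕ
    R = downFrom (suc (length N))

    R² : List (ℕ × ℕ)
    R² = cartesianProduct R R

    ∂< : ∀ u v → ∂ Γ u v < suc (length N)
    ∂< u v = s≤s (firstTrue-≤ (length N) _)

  ∑-R²-point : ∀ u v → ∑ R² (λ k → toℕ (_==₂_ Γ (∂̃ Γ u v) k)) ≡ 1
  ∑-R²-point u v = begin
    ∑ R² (λ k → toℕ (_==₂_ Γ (∂̃ Γ u v) k))                       ≡⟨ ∑-cong R² (λ k → toℕ-∧ ⌊ ∂ Γ u v ℕ.≟ proj₁ k ⌋ ⌊ ∂ Γ v u ℕ.≟ proj₂ k ⌋) ⟩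
    ∑ R² (λ k → toℕ ⌊ ∂ Γ u v ℕ.≟ proj₁ k ⌋ * toℕ ⌊ ∂ Γ v u ℕ.≟ proj₂ k ⌋) ≡⟨ ∑-cartesianProduct-* R R (λ k → toℕ ⌊ ∂ Γ u v ℕ.≟ k ⌋) (λ k → toℕ ⌊ ∂ Γ v u ℕ.≟ k ⌋) ⟩
    ∑ R (λ k → toℕ ⌊ ∂ Γ u v ℕ.≟ k ⌋) * ∑ R (λ k → toℕ ⌊ ∂ Γ v u ℕ.≟ k ⌋) ≡⟨ cong₂ _*_ (∑-downFrom-point (∂< u v)) (∑-downFrom-point (∂< v u)) ⟩
    1                                                               ∎
    where open ≡-Reasoning

  ∑-by-intersection-numbers : ∀ (W : ℕ × ℕ → ℕ × ℕ → ℕ) x y →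
    ∑ N (λ z → W (∂̃ Γ x z) (∂̃ Γ z y)) ≡ ∑ (cartesianProduct R² R²) (uncurry (λ ĩ j̃ → W ĩ j̃ * p Γ ĩ j̃ x y))
  ∑-by-intersection-numbers W x y =
    trans (∑-by-value N (cartesianProduct R² R²) key _≈_ ≈⇒≡ counted-once (uncurry W))
          (∑-cong (cartesianProduct R² R²) (λ k → cong (uncurry W k *_) (sym (length-filter≡∑ _ N))))
    where
    key : V q d → (ℕ × ℕ) × (ℕ × ℕ)
    key z = ∂̃ Γ x z , ∂̃ Γ z y
    _≈_ : (ℕ × ℕ) × (ℕ × ℕ) → (ℕ × ℕ) × (ℕ × ℕ) → Bool
    k ≈ k′ = _==₂_ Γ (proj₁ k) (proj₁ k′) ∧ _==₂_ Γ (proj₂ k) (proj₂ k′)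
    ==₂⇒≡ : ∀ {a b : ℕ × ℕ} → _==₂_ Γ a b ≡ true → a ≡ b
    ==₂⇒≡ {a₁ , a₂} {b₁ , b₂} eq with a₁ ℕ.≟ b₁ | a₂ ℕ.≟ b₂
    ... | yes refl | yes refl = refl
    ≈⇒≡ : ∀ {k k′} → k ≈ k′ ≡ true → k ≡ k′
    ≈⇒≡ {k} {k′} eq with _==₂_ Γ (proj₁ k) (proj₁ k′) in eq₁ | _==₂_ Γ (proj₂ k) (proj₂ k′) in eq₂
    ... | true | true = cong₂ _,_ (==₂⇒≡ eq₁) (==₂⇒≡ eq₂)
    counted-once : ∀ z → ∑ (cartesianProduct R² R²) (λ k → toℕ (key z ≈ k)) ≡ 1
    counted-once z = trans (∑-cong (cartesianProduct R² R²) (λ k → toℕ-∧ (_==₂_ Γ (∂̃ Γ x z) (proj₁ k)) (_==₂_ Γ (∂̃ Γ z y) (proj₂ k))))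
      (trans (∑-cartesianProduct-* R² R² (λ k → toℕ (_==₂_ Γ (∂̃ Γ x z) k)) (λ k → toℕ (_==₂_ Γ (∂̃ Γ z y) k))) (cong₂ _*_ (∑-R²-point x z) (∑-R²-point z y)))

  ∑-∂̃-swap : Commutative Γ → ∀ (W : ℕ × ℕ → ℕ × ℕ → ℕ) x y →
    ∑ N (λ z → W (∂̃ Γ x z) (∂̃ Γ z y)) ≡ ∑ N (λ z → W (∂̃ Γ z y) (∂̃ Γ x z))
  ∑-∂̃-swap commutative W x y = begin
    ∑ N (λ z → W (∂̃ Γ x z) (∂̃ Γ z y))                    ≡⟨ ∑-by-intersection-numbers W x y ⟩
    ∑ D (uncurry (λ ĩ j̃ → W ĩ j̃ * p Γ ĩ j̃ x y))           ≡⟨ ∑-cong D (uncurry (λ ĩ j̃ → cong (W ĩ j̃ *_) (commutative ĩ j̃ x y))) ⟩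
    ∑ D (uncurry (λ ĩ j̃ → W ĩ j̃ * p Γ j̃ ĩ x y))           ≡⟨ ∑-cartesianProduct-flip R² _ ⟩
    ∑ D (uncurry (λ ĩ j̃ → W j̃ ĩ * p Γ ĩ j̃ x y))           ≡⟨ sym (∑-by-intersection-numbers (flip W) x y) ⟩
    ∑ N (λ z → W (∂̃ Γ z y) (∂̃ Γ x z))                    ∎
    where
    open ≡-Reasoning
    D = cartesianProduct R² R²

  ∑-arc-swap : Loopless Γ → Commutative Γ → 2 ≤ length N → ∀ x y →
    ∑ N (λ z → toℕ (Γ x z ∧ (Γ z y ∨ Γ y z))) ≡ ∑ N (λ z → toℕ (Γ z y ∧ (Γ x z ∨ Γ z x)))
  ∑-arc-swap loopless commutative 2≤|V| x y = begin
    ∑ N (λ z → toℕ (Γ x z ∧ (Γ z y ∨ Γ y z))) ≡⟨ ∑-cong N (λ z → sym (W-arcs x z z y)) ⟩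
    ∑ N (λ z → W (∂̃ Γ x z) (∂̃ Γ z y))        ≡⟨ ∑-∂̃-swap commutative W x y ⟩
    ∑ N (λ z → W (∂̃ Γ z y) (∂̃ Γ x z))        ≡⟨ ∑-cong N (λ z → W-arcs z y x z) ⟩
    ∑ N (λ z → toℕ (Γ z y ∧ (Γ x z ∨ Γ z x))) ∎
    where
    open ≡-Reasoning
    W : ℕ × ℕ → ℕ × ℕ → ℕ
    W (a , _) (b , c) = toℕ ((a ≡ᵇ 1) ∧ ((b ≡ᵇ 1) ∨ (c ≡ᵇ 1)))
    W-arcs : ∀ u v w t → W (∂̃ Γ u v) (∂̃ Γ w t) ≡ toℕ (Γ u v ∧ (Γ w t ∨ Γ t w))
    W-arcs u v w t = cong toℕ (cong₂ _∧_ (one u v) (cong₂ _∨_ (one w t) (one t w)))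
      where one = ∂≡ᵇ1 loopless 2≤|V|

module _ {n} (Γ : Digraph q (suc n)) (loopless : Loopless Γ) (hamming-graph : UnderlyingHamming Γ)
         (i : Fin (suc n)) (α : V q n) where

  private
    line : Fin q → V q (suc n)
    line = fibre Γ i α

  adjacent-on-line : ∀ c′ c → (Γ (line c′) (line c) ∨ Γ (line c) (line c′)) ≡ not ⌊ c′ Fin.≟ c ⌋
  adjacent-on-line c′ c with c′ Fin.≟ c
  ... | yes refl rewrite loopless (line c) = refl
  ... | no c′≢c = proj₂ (hamming-graph (line c′) (line c))
    (trans (hamming-insertAt α α i c′ c) (cong₂ _+_ (mismatch-≢ c′≢c) (hamming-refl α)))

  common-out-neighbours : ∀ {b c} → b ≢ c →
    ∑ (allVecs (suc n)) (λ z → toℕ (Γ (line b) z ∧ (Γ z (line c) ∨ Γ (line c) z))) + toℕ (Γ (line b) (line c))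
      ≡ outdeg Γ i α b
  common-out-neighbours {b} {c} b≢c = begin
    ∑ (allVecs (suc n)) (λ z → toℕ (Γ x z ∧ (Γ z y ∨ Γ y z))) + toℕ (Γ x y)
      ≡⟨ cong (_+ toℕ (Γ x y)) (∑-allVecs-line i α _ off-line) ⟩
    ∑ (allFin q) (λ c′ → toℕ (Γ x (line c′) ∧ (Γ (line c′) y ∨ Γ y (line c′)))) + toℕ (Γ x y)
      ≡⟨ cong (_+ toℕ (Γ x y)) (∑-cong (allFin q) on-line) ⟩
    ∑ (allFin q) (λ c′ → toℕ (Γ x (line c′)) * toℕ (not ⌊ c′ Fin.≟ c ⌋)) + toℕ (Γ x y)
      ≡⟨ ∑-allFin-except (λ c′ → toℕ (Γ x (line c′))) c ⟩
    ∑ (allFin q) (λ c′ → toℕ (Γ x (line c′)))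
      ≡⟨ sym (length-filter≡∑ (λ c′ → Γ x (line c′)) (allFin q)) ⟩
    outdeg Γ i α b ∎
    where
    open ≡-Reasoning
    x = line b
    y = line c
    off-line : ∀ β e → β ≢ α → toℕ (Γ x (insertAt β i e) ∧ (Γ (insertAt β i e) y ∨ Γ y (insertAt β i e))) ≡ 0
    off-line β e β≢α with Γ x (insertAt β i e) in arc | Γ (insertAt β i e) y ∨ Γ y (insertAt β i e) in adjacent
    ... | false | _ = refl
    ... | true | false = refl
    ... | true | true = ⊥-elim (b≢c (adjacent-to-line⇒≡ {i = i} {e = e} β≢α
      (proj₁ (hamming-graph x (insertAt β i e)) (cong (_∨ Γ (insertAt β i e) x) arc))
      (proj₁ (hamming-graph (insertAt β i e) y) adjacent)))
    on-line : ∀ c′ → toℕ (Γ x (line c′) ∧ (Γ (line c′) y ∨ Γ y (line c′))) ≡ toℕ (Γ x (line c′)) * toℕ (not ⌊ c′ Fin.≟ c ⌋)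
    on-line c′ = trans (toℕ-∧ (Γ x (line c′)) (Γ (line c′) y ∨ Γ y (line c′))) (cong (λ t → toℕ (Γ x (line c′)) * toℕ t) (adjacent-on-line c′ c))

flip-underlyingHamming : ∀ (Γ : Digraph q d) → UnderlyingHamming Γ → UnderlyingHamming (flip Γ)
flip-underlyingHamming Γ hamming-graph x y =
  (λ adjacent → proj₁ (hamming-graph x y) (trans (∨-comm (Γ x y) (Γ y x)) adjacent)) ,
  (λ h≡1 → trans (∨-comm (Γ y x) (Γ x y)) (proj₂ (hamming-graph x y) h≡1))

outdeg≡indeg : ∀ {n} → 2 ≤ q → (Γ : Digraph q (suc n)) → Loopless Γ → Commutative Γ → UnderlyingHamming Γ →
  ∀ i α {b c} → b ≢ c → outdeg Γ i α b ≡ indeg Γ i α c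
outdeg≡indeg {q} {n} 2≤q Γ loopless commutative hamming-graph i α {b} {c} b≢c = begin
  outdeg Γ i α b
    ≡⟨ sym (common-out-neighbours Γ loopless hamming-graph i α b≢c) ⟩
  ∑ N (λ z → toℕ (Γ x z ∧ (Γ z y ∨ Γ y z))) + toℕ (Γ x y)
    ≡⟨ cong (_+ toℕ (Γ x y)) (∑-arc-swap Γ loopless commutative (2≤length-allVecs 2≤q n) x y) ⟩
  ∑ N (λ z → toℕ (Γ z y ∧ (Γ x z ∨ Γ z x))) + toℕ (Γ x y)
    ≡⟨ common-out-neighbours (flip Γ) loopless (flip-underlyingHamming Γ hamming-graph) i α (≢-sym b≢c) ⟩
  indeg Γ i α c ∎
  where
  open ≡-Reasoning
  N = allVecs {q} (suc n)
  x = fibre Γ i α b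
  y = fibre Γ i α c

third-point : 2 < q → (b c : Fin q) → b ≢ c → ∃ λ w → w ≢ b × w ≢ c
third-point (s≤s (s≤s (s≤s _))) b c b≢c =
  punchIn b (punchIn c′ Fin.zero) , punchInᵢ≢i b _ , w≢c
  where
  c′ = punchOut b≢c
  w≢c : punchIn b (punchIn c′ Fin.zero) ≢ c
  w≢c w≡c = punchInᵢ≢i c′ Fin.zero (punchIn-injective b _ _ (trans w≡c (sym (punchIn-punchOut b≢c))))

lemma4p4 : (q n : ℕ) → q > 2 → (Γ : Digraph q (suc n)) →
    Loopless Γ → WeaklyDistanceRegular Γ → Commutative Γ → UnderlyingHamming Γ →
    (i : Fin (suc n)) (α : V q n) (b c : Fin q) →
    (outdeg Γ i α b ≡ outdeg Γ i α c) × (indeg Γ i α b ≡ indeg Γ i α c)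
lemma4p4 q n q>2 Γ loopless _ commutative hamming-graph i α b c with b Fin.≟ c
... | yes refl = refl , refl
... | no b≢c with third-point q>2 b c b≢c
... | w , w≢b , w≢c =
  trans (out≡in (≢-sym w≢b)) (sym (out≡in (≢-sym w≢c))) , trans (sym (out≡in w≢b)) (out≡in w≢c)
  where out≡in = outdeg≡indeg (<⇒≤ q>2) Γ loopless commutative hamming-graph i α
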